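{- Let $G$ be an ordered group, let $x_1<x_2<x_3$ be elements of $G$ and $S=\{x_1,x_2,x_3\}$. Assume that $x_1x_2\ne x_2x_1$, $x_2x_3\ne x_3x_2$ and $|S^2|=7$. Then, for some $x\in G$ and some $c\in G'$ with $c>1$, $S$ has one of the following forms: (a) $S=\{x,xc,xc^x\}$ or $S=\{x^{ -1},x^{ -1}c,x^{ -1}c^x\}$, where $c^{x^2}=cc^x$ and $cc^x=c^xc$; (b) $S=\{x,xc,xcc^x\}$ or $S=\{x^{ -1},x^{ -1}c,x^{ -1}cc^x\}$, where $c^{x^2}=cc^x$ and $cc^x=c^xc$; (c) $S=\{x,xc,xc^2\}$, where either $c^x=c^2$ or $(c^2)^x=c$. Moreover, in cases (a) and (b) there exist $a,b\in G$ with $\langle S\rangle=\langle a,b\rangle$, $a^{b^2}=aa^b$ and $aa^b=a^ba$, and $\langle S\rangle$ is young of type (iv); in case (c) there exist $a,b\in G$ with $\langle S\rangle=\langle a,b\rangle$ and $a^b=a^2$, and $\langle S\rangle$ is young of type (iii).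
   Context: An ordered group is a group $G$ with a total order $\le$ such that $a\le b$ implies $xay\le xby$ for all $a,b,x,y\in G$. For a subset $S$, $S^2=\{x_1x_2 : x_1,x_2\in S\}$, and $\langle S\rangle$ is the subgroup generated by $S$. $G'$ is the derived subgroup of $G$; $[a,b]=a^{ -1}b^{ -1}ab$ and $a^b=b^{ -1}ab$. An ordered group $H$ is young of type (iii) if $H=\langle a,b\rangle$ with $a^b=a^2$ and $a\ne1$; it is young of type (iv) if $H=\langle a,b\rangle$ with $a^{b^2}=aa^b$, $[a,a^b]=1$ and $a\ne 1$. -}

module Defs where

open import Level using (Level; _⊔_)
open import Algebra.Bundles using (Group)
open import Data.Fin using (Fin; zero; suc)
open import Data.Product using (Σ; ∃; _×_; _,_)
open import Data.Sum using (_⊎_)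
open import Relation.Binary.Core using (Rel)
open import Relation.Binary.Structures using (IsTotalOrder)
open import Relation.Binary.PropositionalEquality using (_≡_)
open import Relation.Nullary using (¬_)

module GroupNotions {c ℓ : Level} (G : Group c ℓ) where
  open Group G

  _^_ : Carrier → Carrier → Carrier
  a ^ b = b ⁻¹ ∙ a ∙ b

  [_,_] : Carrier → Carrier → Carrier
  [ a , b ] = a ⁻¹ ∙ b ⁻¹ ∙ a ∙ b

  sq : Carrier → Carrier
  sq a = a ∙ a

  data ⟨_⟩ {p : Level} (P : Carrier → Set p) : Carrier → Set (c ⊔ ℓ ⊔ p) where
    gen  : ∀ {g} → P g → ⟨ P ⟩ g
    one  : ⟨ P ⟩ ε
    mul  : ∀ {g h} → ⟨ P ⟩ g → ⟨ P ⟩ h → ⟨ P ⟩ (g ∙ h)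
    inv  : ∀ {g} → ⟨ P ⟩ g → ⟨ P ⟩ (g ⁻¹)
    resp : ∀ {g h} → g ≈ h → ⟨ P ⟩ g → ⟨ P ⟩ h

  IsCommutator : Carrier → Set (c ⊔ ℓ)
  IsCommutator g = ∃ λ a → ∃ λ b → g ≈ [ a , b ]

  Derived : Carrier → Set (c ⊔ ℓ)
  Derived = ⟨ IsCommutator ⟩

  Pair : Carrier → Carrier → Carrier → Set ℓ
  Pair a b g = (g ≈ a) ⊎ (g ≈ b)

  SameSubset : ∀ {p q} → (Carrier → Set p) → (Carrier → Set q) → Set (c ⊔ p ⊔ q)
  SameSubset P Q = ∀ g → (P g → Q g) × (Q g → P g)

  Three : Carrier → Carrier → Carrier → Carrier → Set ℓ
  Three y₁ y₂ y₃ g = (g ≈ y₁) ⊎ (g ≈ y₂) ⊎ (g ≈ y₃)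

  SetEq3 : (x₁ x₂ x₃ y₁ y₂ y₃ : Carrier) → Set (c ⊔ ℓ)
  SetEq3 x₁ x₂ x₃ y₁ y₂ y₃ = SameSubset (Three x₁ x₂ x₃) (Three y₁ y₂ y₃)

  -- the family f : I → G takes exactly n distinct values (|{f i}| = n)
  HasCard : ∀ {i} {I : Set i} → (I → Carrier) → (n : _) → Set (ℓ ⊔ i)
  HasCard {I = I} f n =
    Σ (Fin n → I) λ idx →
      (∀ j k → f (idx j) ≈ f (idx k) → j ≡ k)
      × (∀ t → ∃ λ j → f t ≈ f (idx j))

  -- S² for S = {x₁,x₂,x₃}: the family of all products xᵢxⱼ
  sel3 : Carrier → Carrier → Carrier → Fin 3 → Carrier
  sel3 x₁ x₂ x₃ zero = x₁
  sel3 x₁ x₂ x₃ (suc zero) = x₂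
  sel3 x₁ x₂ x₃ (suc (suc zero)) = x₃

  prods3 : Carrier → Carrier → Carrier → Fin 3 × Fin 3 → Carrier
  prods3 x₁ x₂ x₃ (i , j) = sel3 x₁ x₂ x₃ i ∙ sel3 x₁ x₂ x₃ j

  -- young groups of type (iii) and (iv), for a subgroup H given by its membership predicate
  -- (the order on H is the restriction of the order on G)
  YoungIII : ∀ {p} → (Carrier → Set p) → Set (c ⊔ ℓ ⊔ p)
  YoungIII H = ∃ λ a → ∃ λ b →
    SameSubset H ⟨ Pair a b ⟩ × (a ^ b ≈ sq a) × ¬ (a ≈ ε)

  YoungIV : ∀ {p} → (Carrier → Set p) → Set (c ⊔ ℓ ⊔ p)
  YoungIV H = ∃ λ a → ∃ λ b →
    SameSubset H ⟨ Pair a b ⟩ × (a ^ sq b ≈ a ∙ (a ^ b)) × ([ a , a ^ b ] ≈ ε) × ¬ (a ≈ ε)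

record IsOrderedGroup {c ℓ ℓ′ : Level} (G : Group c ℓ) (_≤_ : Rel (Group.Carrier G) ℓ′)
       : Set (c ⊔ ℓ ⊔ ℓ′) where
  open Group G
  field
    isTotalOrder : IsTotalOrder _≈_ _≤_
    compatible   : ∀ {a b} x y → a ≤ b → (x ∙ a ∙ y) ≤ (x ∙ b ∙ y)

Strict : {c ℓ ℓ′ : Level} (G : Group c ℓ) → Rel (Group.Carrier G) ℓ′ → Rel (Group.Carrier G) (ℓ ⊔ ℓ′)
Strict G _≤_ a b = (a ≤ b) × ¬ (Group._≈_ G a b)

-- Put x = x₁ and c = x₁⁻¹x₂ > 1. The order separates the seven products x₁x₁, x₁x₂, x₂x₁,
-- x₂x₂, x₂x₃, x₃x₂, x₃x₃ except for the two non-commuting pairs, so |S²| = 7 forces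
-- x₁x₃ ∈ {x₂x₁, x₂x₂, x₃x₂} and x₃x₁ ∈ {x₁x₂, x₂x₂, x₂x₃}. Three of the nine combinations
-- make some xᵢ commute with the square of another, hence (squaring being injective in an
-- ordered group) with its root, which contradicts the hypotheses. In the other six,
-- eliminating x₃ leaves a conjugation relation between c and x or x⁻¹. In cases (a) and (b)
-- conjugation by x, which preserves the order, interchanges c c^x and c^x c up to common
-- factors, so the two are equal. The relations then present c as a commutator and give ⟨S⟩ = ⟨c, x^{±1}⟩.
module Submission where

open import Level using (Level; _⊔_)
open import Algebra.Bundles using (Group)
open import Data.Empty using (⊥; ⊥-elim)
open import Data.Fin as Fin using (Fin; zero; suc)
open import Data.Fin.Patterns using (0F; 1F; 2F; 3F; 4F; 5F; 6F)
open import Data.Fin.Properties as Fin using (pigeonhole)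
open import Data.Product.Properties using () renaming (≡-dec to ×-≡-dec)
open import Data.Vec as Vec using (_∷_; [])
open import Data.Nat using (suc; s≤s)
open import Data.Nat.Properties using (n<1+n)
open import Data.Product using (∃; ∃₂; _×_; _,_; proj₁; proj₂)
open import Data.Sum using (_⊎_; inj₁; inj₂)
open import Relation.Binary.Core using (Rel)
open import Relation.Binary.Structures using (IsTotalOrder)
open import Function using (_∘_)
open import Relation.Binary.PropositionalEquality as ≡ using (_≡_)
open import Relation.Nullary using (¬_; Dec)
open import Relation.Nullary.Decidable using (_×-dec_; _⊎-dec_; _→-dec_; toWitness)
open import Defs

module ConjugationProperties {o ℓ : Level} (G : Group o ℓ) where
  open Group G
  open GroupNotions G
  open import Algebra.Properties.Group G
  open import Relation.Binary.Reasoning.Setoid setoid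

  ^-congˡ : ∀ {a b} t → a ≈ b → a ^ t ≈ b ^ t
  ^-congˡ t a≈b = ∙-congʳ (∙-congˡ a≈b)

  ∙-^ : ∀ a t → t ∙ a ^ t ≈ a ∙ t
  ∙-^ a t = begin
    t ∙ (t ⁻¹ ∙ a ∙ t)    ≈⟨ assoc t (t ⁻¹ ∙ a) t ⟨
    t ∙ (t ⁻¹ ∙ a) ∙ t    ≈⟨ ∙-congʳ (\\-leftDividesˡ t a) ⟩
    a ∙ t                 ∎

  ^-unique : ∀ {a g} t → t ∙ g ≈ a ∙ t → g ≈ a ^ t
  ^-unique {a} {g} t h = ∙-cancelˡ t g (a ^ t) (trans h (sym (∙-^ a t)))

  ^⁻¹-∙ : ∀ a t → a ^ (t ⁻¹) ∙ t ≈ t ∙ a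
  ^⁻¹-∙ a t = begin
    t ⁻¹ ⁻¹ ∙ a ∙ t ⁻¹ ∙ t   ≈⟨ //-rightDividesˡ t (t ⁻¹ ⁻¹ ∙ a) ⟩
    t ⁻¹ ⁻¹ ∙ a              ≈⟨ ∙-congʳ (⁻¹-involutive t) ⟩
    t ∙ a                    ∎

  ^⁻¹-^ : ∀ a t → (a ^ (t ⁻¹)) ^ t ≈ a
  ^⁻¹-^ a t = sym (^-unique t (sym (^⁻¹-∙ a t)))

  ^-^⁻¹ : ∀ a t → (a ^ t) ^ (t ⁻¹) ≈ a
  ^-^⁻¹ a t = sym (^-unique (t ⁻¹) (sym (//-rightDividesʳ t (t ⁻¹ ∙ a))))

  ^-distrib-∙ : ∀ a b t → (a ∙ b) ^ t ≈ a ^ t ∙ b ^ t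
  ^-distrib-∙ a b t = sym (^-unique t (begin
    t ∙ (a ^ t ∙ b ^ t)    ≈⟨ assoc t (a ^ t) (b ^ t) ⟨
    t ∙ a ^ t ∙ b ^ t      ≈⟨ ∙-congʳ (∙-^ a t) ⟩
    a ∙ t ∙ b ^ t          ≈⟨ assoc a t (b ^ t) ⟩
    a ∙ (t ∙ b ^ t)        ≈⟨ ∙-congˡ (∙-^ b t) ⟩
    a ∙ (b ∙ t)            ≈⟨ assoc a b t ⟨
    a ∙ b ∙ t              ∎))

  ^-^ : ∀ a s t → (a ^ s) ^ t ≈ a ^ (s ∙ t)
  ^-^ a s t = ^-unique (s ∙ t) (begin
    s ∙ t ∙ (a ^ s) ^ t    ≈⟨ assoc s t ((a ^ s) ^ t) ⟩
    s ∙ (t ∙ (a ^ s) ^ t)  ≈⟨ ∙-congˡ (∙-^ (a ^ s) t) ⟩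
    s ∙ (a ^ s ∙ t)        ≈⟨ assoc s (a ^ s) t ⟨
    s ∙ a ^ s ∙ t          ≈⟨ ∙-congʳ (∙-^ a s) ⟩
    a ∙ s ∙ t              ≈⟨ assoc a s t ⟩
    a ∙ (s ∙ t)            ∎)

  ^-over-∙^ : ∀ c t → (c ∙ c ^ t) ^ t ≈ c ^ t ∙ c ^ sq t
  ^-over-∙^ c t = trans (^-distrib-∙ c (c ^ t) t) (∙-congˡ (^-^ c t t))

  ^-over-^∙ : ∀ c t → (c ^ t ∙ c) ^ t ≈ c ^ sq t ∙ c ^ t
  ^-over-^∙ c t = trans (^-distrib-∙ (c ^ t) c t) (∙-congʳ (^-^ c t t))

  ^-fixed : ∀ {a t} → t ∙ a ≈ a ∙ t → a ^ t ≈ a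
  ^-fixed {a} {t} h = sym (^-unique t h)

  commute-of-^-fixed : ∀ {a t} → a ^ t ≈ a → t ∙ a ≈ a ∙ t
  commute-of-^-fixed {a} {t} h = trans (∙-congˡ (sym h)) (∙-^ a t)

  commutator≈⁻¹∙^ : ∀ a t → [ a , t ] ≈ a ⁻¹ ∙ a ^ t
  commutator≈⁻¹∙^ a t = begin
    a ⁻¹ ∙ t ⁻¹ ∙ a ∙ t      ≈⟨ ∙-congʳ (assoc (a ⁻¹) (t ⁻¹) a) ⟩
    a ⁻¹ ∙ (t ⁻¹ ∙ a) ∙ t    ≈⟨ assoc (a ⁻¹) (t ⁻¹ ∙ a) t ⟩
    a ⁻¹ ∙ a ^ t             ∎

  commutator≈ε : ∀ {a b} → b ∙ a ≈ a ∙ b → [ a , b ] ≈ ε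
  commutator≈ε {a} {b} h = trans (commutator≈⁻¹∙^ a b) (trans (∙-congˡ (^-fixed h)) (inverseˡ a))

  TypeIV : Carrier → Carrier → Set ℓ
  TypeIV c t = (c ^ sq t ≈ c ∙ c ^ t) × (c ∙ c ^ t ≈ c ^ t ∙ c)

  derived-of-typeIV : ∀ {c t} → TypeIV c t → Derived c
  derived-of-typeIV {c} {t} (rel , comm) = gen (c ^ t , t , sym (begin
    [ c ^ t , t ]               ≈⟨ commutator≈⁻¹∙^ (c ^ t) t ⟩
    (c ^ t) ⁻¹ ∙ (c ^ t) ^ t    ≈⟨ ∙-congˡ (^-^ c t t) ⟩
    (c ^ t) ⁻¹ ∙ c ^ sq t       ≈⟨ ∙-congˡ (trans rel comm) ⟩
    (c ^ t) ⁻¹ ∙ (c ^ t ∙ c)    ≈⟨ \\-leftDividesʳ (c ^ t) c ⟩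
    c                           ∎))

  derived-of-^≈sq : ∀ {c t} → c ^ t ≈ sq c → Derived c
  derived-of-^≈sq {c} {t} c^t≈c² = gen (c , t , sym (begin
    [ c , t ]        ≈⟨ commutator≈⁻¹∙^ c t ⟩
    c ⁻¹ ∙ c ^ t     ≈⟨ ∙-congˡ c^t≈c² ⟩
    c ⁻¹ ∙ sq c      ≈⟨ \\-leftDividesʳ c c ⟩
    c                ∎))

module OrderedGroupProperties {o ℓ ℓ′ : Level} (G : Group o ℓ) (R : Rel (Group.Carrier G) ℓ′)
                              (isOrderedGroup : IsOrderedGroup G R) where
  open Group G
  open GroupNotions G
  open ConjugationProperties G
  open IsOrderedGroup isOrderedGroup
  open IsTotalOrder isTotalOrder using (total; antisym; ≤-respˡ-≈; ≤-respʳ-≈)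
    renaming (trans to ≤-trans)
  open import Algebra.Properties.Group G
  open import Relation.Binary.Reasoning.Setoid setoid

  infix 4 _≤_ _<_
  _≤_ : Rel Carrier ℓ′
  _≤_ = R

  _<_ : Rel Carrier (ℓ ⊔ ℓ′)
  _<_ = Strict G R

  ∙-monoʳ-≤ : ∀ {a b} t → a ≤ b → t ∙ a ≤ t ∙ b
  ∙-monoʳ-≤ t a≤b = ≤-respʳ-≈ (identityʳ _) (≤-respˡ-≈ (identityʳ _) (compatible t ε a≤b))

  ∙-monoˡ-≤ : ∀ {a b} t → a ≤ b → a ∙ t ≤ b ∙ t
  ∙-monoˡ-≤ t a≤b =
    ≤-respʳ-≈ (∙-congʳ (identityˡ _)) (≤-respˡ-≈ (∙-congʳ (identityˡ _)) (compatible ε t a≤b))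

  ∙-monoʳ-< : ∀ {a b} t → a < b → t ∙ a < t ∙ b
  ∙-monoʳ-< t (a≤b , a≉b) = ∙-monoʳ-≤ t a≤b , λ e → a≉b (∙-cancelˡ t _ _ e)

  ∙-monoˡ-< : ∀ {a b} t → a < b → a ∙ t < b ∙ t
  ∙-monoˡ-< t (a≤b , a≉b) = ∙-monoˡ-≤ t a≤b , λ e → a≉b (∙-cancelʳ t _ _ e)

  <⇒≉ : ∀ {a b} → a < b → ¬ (a ≈ b)
  <⇒≉ = proj₂

  <-respˡ-≈ : ∀ {a b d} → a ≈ b → a < d → b < d
  <-respˡ-≈ a≈b (a≤d , a≉d) = ≤-respˡ-≈ a≈b a≤d , λ b≈d → a≉d (trans a≈b b≈d)

  <-trans : ∀ {a b d} → a < b → b < d → a < d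
  <-trans (a≤b , a≉b) (b≤d , _) =
    ≤-trans a≤b b≤d , λ a≈d → a≉b (antisym a≤b (≤-respʳ-≈ (sym a≈d) b≤d))

  ^-mono-≤ : ∀ {a b} t → a ≤ b → a ^ t ≤ b ^ t
  ^-mono-≤ t = compatible (t ⁻¹) t

  ≤-cancel : ∀ {a b} w w′ → w ∙ a ∙ w′ ≤ w ∙ b ∙ w′ → a ≤ b
  ≤-cancel w w′ h = ≤-respˡ-≈ (unwrap _) (≤-respʳ-≈ (unwrap _) (compatible (w ⁻¹) (w′ ⁻¹) h))
    where
      unwrap : ∀ a → w ⁻¹ ∙ (w ∙ a ∙ w′) ∙ w′ ⁻¹ ≈ a
      unwrap a = begin
        w ⁻¹ ∙ (w ∙ a ∙ w′) ∙ w′ ⁻¹   ≈⟨ ∙-congʳ (assoc (w ⁻¹) (w ∙ a) w′) ⟨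
        w ⁻¹ ∙ (w ∙ a) ∙ w′ ∙ w′ ⁻¹   ≈⟨ //-rightDividesʳ w′ (w ⁻¹ ∙ (w ∙ a)) ⟩
        w ⁻¹ ∙ (w ∙ a)                ≈⟨ \\-leftDividesʳ w a ⟩
        a                             ∎

  -- Conjugation by t is monotone, so p ≤ q and q ≤ p imply each other.
  ≈-of-swapped-^ : ∀ {p q} t w w′ → p ^ t ≈ w ∙ q ∙ w′ → q ^ t ≈ w ∙ p ∙ w′ → p ≈ q
  ≈-of-swapped-^ {p} {q} t w w′ hp hq with total p q
  ... | inj₁ p≤q = antisym p≤q (≤-cancel w w′ (≤-respˡ-≈ hp (≤-respʳ-≈ hq (^-mono-≤ t p≤q))))
  ... | inj₂ q≤p = antisym (≤-cancel w w′ (≤-respˡ-≈ hq (≤-respʳ-≈ hp (^-mono-≤ t q≤p)))) q≤p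

  sq-injective : ∀ {a b} → sq a ≈ sq b → a ≈ b
  sq-injective {a} {b} e with total a b
  ... | inj₁ a≤b = ∙-cancelˡ a a b (antisym (∙-monoʳ-≤ a a≤b) (≤-respʳ-≈ (sym e) (∙-monoˡ-≤ b a≤b)))
  ... | inj₂ b≤a = sym (∙-cancelˡ b b a (antisym (∙-monoʳ-≤ b b≤a) (≤-respʳ-≈ e (∙-monoˡ-≤ a b≤a))))

  commute-of-commute-sq : ∀ {a b} → a ∙ sq b ≈ sq b ∙ a → a ∙ b ≈ b ∙ a
  commute-of-commute-sq {a} {b} h = commute-of-^-fixed (sq-injective (begin
    b ^ a ∙ b ^ a   ≈⟨ ^-distrib-∙ b b a ⟨
    sq b ^ a        ≈⟨ ^-fixed h ⟩
    sq b            ∎))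

  module _ (c t : Carrier) where
    private
      v : Carrier
      v = c ^ t

    typeIV-of-^sq≈^∙ : c ^ sq t ≈ v ∙ c → TypeIV c t
    typeIV-of-^sq≈^∙ h = trans h (sym comm) , comm
      where
        comm : c ∙ v ≈ v ∙ c
        comm = ≈-of-swapped-^ t v ε
          (begin
            (c ∙ v) ^ t        ≈⟨ ^-over-∙^ c t ⟩
            v ∙ c ^ sq t       ≈⟨ ∙-congˡ h ⟩
            v ∙ (v ∙ c)        ≈⟨ identityʳ _ ⟨
            v ∙ (v ∙ c) ∙ ε    ∎)
          (begin
            (v ∙ c) ^ t        ≈⟨ ^-over-^∙ c t ⟩
            c ^ sq t ∙ v       ≈⟨ ∙-congʳ h ⟩
            v ∙ c ∙ v          ≈⟨ assoc v c v ⟩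
            v ∙ (c ∙ v)        ≈⟨ identityʳ _ ⟨
            v ∙ (c ∙ v) ∙ ε    ∎)

    typeIV-of-^sq≈∙^ : c ^ sq t ≈ c ∙ v → TypeIV c t
    typeIV-of-^sq≈∙^ h = h , comm
      where
        comm : c ∙ v ≈ v ∙ c
        comm = ≈-of-swapped-^ t ε v
          (begin
            (c ∙ v) ^ t        ≈⟨ ^-over-∙^ c t ⟩
            v ∙ c ^ sq t       ≈⟨ ∙-congˡ h ⟩
            v ∙ (c ∙ v)        ≈⟨ assoc v c v ⟨
            v ∙ c ∙ v          ≈⟨ ∙-congʳ (identityˡ _) ⟨
            ε ∙ (v ∙ c) ∙ v    ∎)
          (begin
            (v ∙ c) ^ t        ≈⟨ ^-over-^∙ c t ⟩
            c ^ sq t ∙ v       ≈⟨ ∙-congʳ h ⟩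
            c ∙ v ∙ v          ≈⟨ ∙-congʳ (identityˡ _) ⟨
            ε ∙ (c ∙ v) ∙ v    ∎)

    typeIV-of-^∙-^ : (v ∙ c) ^ t ≈ v ∙ (v ∙ c) → TypeIV c t
    typeIV-of-^∙-^ h = rel , comm
      where
        c^t²≈ : c ^ sq t ≈ v ∙ (v ∙ c) ∙ v ⁻¹
        c^t²≈ = begin
          c ^ sq t                 ≈⟨ //-rightDividesʳ v (c ^ sq t) ⟨
          c ^ sq t ∙ v ∙ v ⁻¹      ≈⟨ ∙-congʳ (trans (sym (^-over-^∙ c t)) h) ⟩
          v ∙ (v ∙ c) ∙ v ⁻¹       ∎
        comm : c ∙ v ≈ v ∙ c
        comm = ≈-of-swapped-^ t (v ∙ v) (v ⁻¹)
          (begin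
            (c ∙ v) ^ t              ≈⟨ ^-over-∙^ c t ⟩
            v ∙ c ^ sq t             ≈⟨ ∙-congˡ c^t²≈ ⟩
            v ∙ (v ∙ (v ∙ c) ∙ v ⁻¹) ≈⟨ assoc v (v ∙ (v ∙ c)) (v ⁻¹) ⟨
            v ∙ (v ∙ (v ∙ c)) ∙ v ⁻¹ ≈⟨ ∙-congʳ (assoc v v (v ∙ c)) ⟨
            v ∙ v ∙ (v ∙ c) ∙ v ⁻¹   ∎)
          (begin
            (v ∙ c) ^ t              ≈⟨ h ⟩
            v ∙ (v ∙ c)              ≈⟨ assoc v v c ⟨
            v ∙ v ∙ c                ≈⟨ //-rightDividesʳ v (v ∙ v ∙ c) ⟨
            v ∙ v ∙ c ∙ v ∙ v ⁻¹     ≈⟨ ∙-congʳ (assoc (v ∙ v) c v) ⟩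
            v ∙ v ∙ (c ∙ v) ∙ v ⁻¹   ∎)
        rel : c ^ sq t ≈ c ∙ v
        rel = begin
          c ^ sq t                 ≈⟨ c^t²≈ ⟩
          v ∙ (v ∙ c) ∙ v ⁻¹       ≈⟨ ∙-congʳ (∙-congˡ comm) ⟨
          v ∙ (c ∙ v) ∙ v ⁻¹       ≈⟨ ∙-congʳ (assoc v c v) ⟨
          v ∙ c ∙ v ∙ v ⁻¹         ≈⟨ //-rightDividesʳ v (v ∙ c) ⟩
          v ∙ c                    ≈⟨ comm ⟨
          c ∙ v                    ∎

    typeIV-of-∙^-^ : (c ∙ v) ^ t ≈ c ∙ v ∙ v → TypeIV c t
    typeIV-of-∙^-^ h = rel , comm
      where
        c^t²≈ : c ^ sq t ≈ v ⁻¹ ∙ (c ∙ v ∙ v)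
        c^t²≈ = begin
          c ^ sq t                 ≈⟨ \\-leftDividesʳ v (c ^ sq t) ⟨
          v ⁻¹ ∙ (v ∙ c ^ sq t)    ≈⟨ ∙-congˡ (trans (sym (^-over-∙^ c t)) h) ⟩
          v ⁻¹ ∙ (c ∙ v ∙ v)       ∎
        comm : c ∙ v ≈ v ∙ c
        comm = ≈-of-swapped-^ t (v ⁻¹) (v ∙ v)
          (begin
            (c ∙ v) ^ t              ≈⟨ h ⟩
            c ∙ v ∙ v                ≈⟨ assoc c v v ⟩
            c ∙ (v ∙ v)              ≈⟨ ∙-congʳ (\\-leftDividesʳ v c) ⟨
            v ⁻¹ ∙ (v ∙ c) ∙ (v ∙ v) ∎)
          (begin
            (v ∙ c) ^ t              ≈⟨ ^-over-^∙ c t ⟩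
            c ^ sq t ∙ v             ≈⟨ ∙-congʳ c^t²≈ ⟩
            v ⁻¹ ∙ (c ∙ v ∙ v) ∙ v   ≈⟨ ∙-congʳ (assoc (v ⁻¹) (c ∙ v) v) ⟨
            v ⁻¹ ∙ (c ∙ v) ∙ v ∙ v   ≈⟨ assoc (v ⁻¹ ∙ (c ∙ v)) v v ⟩
            v ⁻¹ ∙ (c ∙ v) ∙ (v ∙ v) ∎)
        rel : c ^ sq t ≈ c ∙ v
        rel = begin
          c ^ sq t                 ≈⟨ c^t²≈ ⟩
          v ⁻¹ ∙ (c ∙ v ∙ v)       ≈⟨ ∙-congˡ (∙-congʳ comm) ⟩
          v ⁻¹ ∙ (v ∙ c ∙ v)       ≈⟨ ∙-congˡ (assoc v c v) ⟩
          v ⁻¹ ∙ (v ∙ (c ∙ v))     ≈⟨ \\-leftDividesʳ v (c ∙ v) ⟩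
          c ∙ v                    ∎

module SubgroupProperties {o ℓ : Level} (G : Group o ℓ) where
  open Group G
  open GroupNotions G

  ⟨⟩-least : ∀ {p q} {P : Carrier → Set p} {Q : Carrier → Set q} →
             (∀ {g} → P g → ⟨ Q ⟩ g) → ∀ {g} → ⟨ P ⟩ g → ⟨ Q ⟩ g
  ⟨⟩-least P⊆Q (gen Pg)     = P⊆Q Pg
  ⟨⟩-least P⊆Q one          = one
  ⟨⟩-least P⊆Q (mul g h)    = mul (⟨⟩-least P⊆Q g) (⟨⟩-least P⊆Q h)
  ⟨⟩-least P⊆Q (inv g)      = inv (⟨⟩-least P⊆Q g)
  ⟨⟩-least P⊆Q (resp g≈h g) = resp g≈h (⟨⟩-least P⊆Q g)

  ⟨⟩-same : ∀ {p q} {P : Carrier → Set p} {Q : Carrier → Set q} →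
            (∀ {g} → P g → ⟨ Q ⟩ g) → (∀ {g} → Q g → ⟨ P ⟩ g) → SameSubset ⟨ P ⟩ ⟨ Q ⟩
  ⟨⟩-same P⊆Q Q⊆P g = ⟨⟩-least P⊆Q , ⟨⟩-least Q⊆P

  ^-closed : ∀ {p} {P : Carrier → Set p} {a t} → ⟨ P ⟩ a → ⟨ P ⟩ t → ⟨ P ⟩ (a ^ t)
  ^-closed a∈ t∈ = mul (mul (inv t∈) a∈) t∈

  SetEq3-of-≈ : ∀ {x₁ x₂ x₃ y₁ y₂ y₃} → x₁ ≈ y₁ → x₂ ≈ y₂ → x₃ ≈ y₃ → SetEq3 x₁ x₂ x₃ y₁ y₂ y₃
  SetEq3-of-≈ e₁ e₂ e₃ g = to , from
    where
      to : Three _ _ _ g → Three _ _ _ g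
      to (inj₁ g≈x₁)        = inj₁ (trans g≈x₁ e₁)
      to (inj₂ (inj₁ g≈x₂)) = inj₂ (inj₁ (trans g≈x₂ e₂))
      to (inj₂ (inj₂ g≈x₃)) = inj₂ (inj₂ (trans g≈x₃ e₃))
      from : Three _ _ _ g → Three _ _ _ g
      from (inj₁ g≈y₁)        = inj₁ (trans g≈y₁ (sym e₁))
      from (inj₂ (inj₁ g≈y₂)) = inj₂ (inj₁ (trans g≈y₂ (sym e₂)))
      from (inj₂ (inj₂ g≈y₃)) = inj₂ (inj₂ (trans g≈y₃ (sym e₃)))

module CardinalityProperties {o ℓ : Level} (G : Group o ℓ) where
  open Group G
  open GroupNotions G

  -- Pigeonhole on the n + 1 indices t, g 0, …, g (n - 1).
  covered-by-distinct : ∀ {i n} {I : Set i} (f : I → Carrier) → HasCard f n →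
                        (g : Fin n → I) → (∀ {j k} → j Fin.< k → ¬ (f (g j) ≈ f (g k))) →
                        ∀ t → ∃ λ k → f t ≈ f (g k)
  covered-by-distinct {n = n} {I} f (idx , _ , onto) g distinct t =
    collision (pigeonhole (n<1+n n) class)
    where
      extend : Fin (suc n) → I
      extend zero    = t
      extend (suc k) = g k

      class : Fin (suc n) → Fin n
      class i = proj₁ (onto (extend i))

      same-class : ∀ {i j} → class i ≡ class j → f (extend i) ≈ f (extend j)
      same-class {i} {j} eq = trans (proj₂ (onto (extend i)))
        (trans (reflexive (≡.cong (f ∘ idx) eq)) (sym (proj₂ (onto (extend j)))))

      collision : (∃₂ λ i j → i Fin.< j × class i ≡ class j) → ∃ λ k → f t ≈ f (g k)
      collision (zero  , suc k , _       , eq) = k , same-class {zero} eq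
      collision (suc j , suc k , s≤s j<k , eq) = ⊥-elim (distinct j<k (same-class eq))


module Classification {o ℓ ℓ′ : Level} (G : Group o ℓ) (R : Rel (Group.Carrier G) ℓ′)
                      (isOrderedGroup : IsOrderedGroup G R) where
  open Group G
  open GroupNotions G
  open ConjugationProperties G
  open OrderedGroupProperties G R isOrderedGroup
  open SubgroupProperties G
  open CardinalityProperties G
  open import Algebra.Properties.Group G

  module Products (x₁ x₂ x₃ : Carrier) (x₁<x₂ : x₁ < x₂) (x₂<x₃ : x₂ < x₃)
                  (x₁x₂≉x₂x₁ : ¬ (x₁ ∙ x₂ ≈ x₂ ∙ x₁)) (x₂x₃≉x₃x₂ : ¬ (x₂ ∙ x₃ ≈ x₃ ∙ x₂)) where
    x₁<x₃ : x₁ < x₃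
    x₁<x₃ = <-trans x₁<x₂ x₂<x₃

    sel3-strictMono : ∀ {i j} → i Fin.< j → sel3 x₁ x₂ x₃ i < sel3 x₁ x₂ x₃ j
    sel3-strictMono {0F} {1F} _ = x₁<x₂
    sel3-strictMono {0F} {2F} _ = x₁<x₃
    sel3-strictMono {1F} {2F} _ = x₂<x₃
    sel3-strictMono {_}  {0F} ()
    sel3-strictMono {1F} {1F} (s≤s ())
    sel3-strictMono {2F} {1F} (s≤s ())
    sel3-strictMono {2F} {2F} (s≤s (s≤s ()))

    infix 4 _⊏_ _⊏?_
    _⊏_ : Fin 3 × Fin 3 → Fin 3 × Fin 3 → Set
    (i , j) ⊏ (i′ , j′) = (i Fin.< i′ × j ≡ j′) ⊎ (i ≡ i′ × j Fin.< j′) ⊎ (i Fin.< i′ × j Fin.< j′)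

    _⊏?_ : ∀ p q → Dec (p ⊏ q)
    (i , j) ⊏? (i′ , j′) = (i Fin.<? i′ ×-dec j Fin.≟ j′) ⊎-dec (i Fin.≟ i′ ×-dec j Fin.<? j′)
                           ⊎-dec (i Fin.<? i′ ×-dec j Fin.<? j′)

    products-strictMono : ∀ {p q} → p ⊏ q → prods3 x₁ x₂ x₃ p < prods3 x₁ x₂ x₃ q
    products-strictMono {_ , j} (inj₁ (i<i′ , ≡.refl)) = ∙-monoˡ-< (sel3 x₁ x₂ x₃ j) (sel3-strictMono i<i′)
    products-strictMono {i , _} (inj₂ (inj₁ (≡.refl , j<j′))) = ∙-monoʳ-< (sel3 x₁ x₂ x₃ i) (sel3-strictMono j<j′)
    products-strictMono (inj₂ (inj₂ (i<i′ , j<j′))) =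
      <-trans (∙-monoˡ-< _ (sel3-strictMono i<i′)) (∙-monoʳ-< _ (sel3-strictMono j<j′))

    -- The seven products other than x₁x₃ and x₃x₁; only the pairs 1,2 and 4,5 are incomparable.
    seven : Fin 7 → Fin 3 × Fin 3
    seven = Vec.lookup ((0F , 0F) ∷ (0F , 1F) ∷ (1F , 0F) ∷ (1F , 1F) ∷ (1F , 2F) ∷ (2F , 1F) ∷ (2F , 2F) ∷ [])

    Separated : Fin 7 → Fin 7 → Set
    Separated j k = seven j ⊏ seven k ⊎ (j , k) ≡ (1F , 2F) ⊎ (j , k) ≡ (4F , 5F)

    seven-separated : ∀ j k → j Fin.< k → Separated j k
    seven-separated = toWitness {a? = Fin.all? λ j → Fin.all? λ k → j Fin.<? k →-dec separated? j k} _
      where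
        separated? : ∀ j k → Dec (Separated j k)
        separated? j k = seven j ⊏? seven k ⊎-dec pair? (j , k) (1F , 2F) ⊎-dec pair? (j , k) (4F , 5F)
          where pair? = ×-≡-dec Fin._≟_ Fin._≟_

    seven-distinct : ∀ {j k} → j Fin.< k → ¬ (prods3 x₁ x₂ x₃ (seven j) ≈ prods3 x₁ x₂ x₃ (seven k))
    seven-distinct {j} {k} j<k with seven-separated j k j<k
    ... | inj₁ below                 = <⇒≉ (products-strictMono below)
    ... | inj₂ (inj₁ ≡.refl)         = x₁x₂≉x₂x₁
    ... | inj₂ (inj₂ ≡.refl)         = x₂x₃≉x₃x₂

    module _ (card : HasCard (prods3 x₁ x₂ x₃) 7) where
      covered : ∀ t → ∃ λ k → prods3 x₁ x₂ x₃ t ≈ prods3 x₁ x₂ x₃ (seven k)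
      covered = covered-by-distinct (prods3 x₁ x₂ x₃) card seven seven-distinct

      x₁x₃-cases : (x₁ ∙ x₃ ≈ x₂ ∙ x₁) ⊎ (x₁ ∙ x₃ ≈ x₂ ∙ x₂) ⊎ (x₁ ∙ x₃ ≈ x₃ ∙ x₂)
      x₁x₃-cases with covered (0F , 2F)
      ... | 0F , e = ⊥-elim (<⇒≉ (∙-monoʳ-< x₁ x₁<x₃) (sym e))
      ... | 1F , e = ⊥-elim (<⇒≉ (∙-monoʳ-< x₁ x₂<x₃) (sym e))
      ... | 2F , e = inj₁ e
      ... | 3F , e = inj₂ (inj₁ e)
      ... | 4F , e = ⊥-elim (<⇒≉ (∙-monoˡ-< x₃ x₁<x₂) e)
      ... | 5F , e = inj₂ (inj₂ e)
      ... | 6F , e = ⊥-elim (<⇒≉ (∙-monoˡ-< x₃ x₁<x₃) e)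

      x₃x₁-cases : (x₃ ∙ x₁ ≈ x₁ ∙ x₂) ⊎ (x₃ ∙ x₁ ≈ x₂ ∙ x₂) ⊎ (x₃ ∙ x₁ ≈ x₂ ∙ x₃)
      x₃x₁-cases with covered (2F , 0F)
      ... | 0F , e = ⊥-elim (<⇒≉ (∙-monoˡ-< x₁ x₁<x₃) (sym e))
      ... | 1F , e = inj₁ e
      ... | 2F , e = ⊥-elim (<⇒≉ (∙-monoˡ-< x₁ x₂<x₃) (sym e))
      ... | 3F , e = inj₂ (inj₁ e)
      ... | 4F , e = inj₂ (inj₂ e)
      ... | 5F , e = ⊥-elim (<⇒≉ (∙-monoʳ-< x₃ x₁<x₂) e)
      ... | 6F , e = ⊥-elim (<⇒≉ (∙-monoʳ-< x₃ x₁<x₃) e)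

  module Shapes (x₁ x₂ x₃ : Carrier) where
    S : Carrier → Set ℓ
    S = Three x₁ x₂ x₃

    ShapeAB : Carrier → Carrier → (Carrier → Carrier) → Set (o ⊔ ℓ)
    ShapeAB x c third =
      ( SetEq3 x₁ x₂ x₃ x (x ∙ c) (third x)
        ⊎ SetEq3 x₁ x₂ x₃ (x ⁻¹) (x ⁻¹ ∙ c) (third (x ⁻¹)) )
      × (c ^ sq x ≈ c ∙ (c ^ x)) × (c ∙ (c ^ x) ≈ (c ^ x) ∙ c)
      × (∃ λ a → ∃ λ b → SameSubset ⟨ S ⟩ ⟨ Pair a b ⟩
           × (a ^ sq b ≈ a ∙ (a ^ b)) × (a ∙ (a ^ b) ≈ (a ^ b) ∙ a))
      × YoungIV ⟨ S ⟩

    ShapeC : Carrier → Carrier → Set (o ⊔ ℓ)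
    ShapeC x c =
      SetEq3 x₁ x₂ x₃ x (x ∙ c) (x ∙ sq c)
      × ((c ^ x ≈ sq c) ⊎ (sq c ^ x ≈ c))
      × (∃ λ a → ∃ λ b → SameSubset ⟨ S ⟩ ⟨ Pair a b ⟩ × (a ^ b ≈ sq a))
      × YoungIII ⟨ S ⟩

    ShapeA ShapeB : Carrier → Carrier → Set (o ⊔ ℓ)
    ShapeA x c = ShapeAB x c (λ y → y ∙ (c ^ x))
    ShapeB x c = ShapeAB x c (λ y → y ∙ c ∙ (c ^ x))

    Conclusion : Set (o ⊔ ℓ ⊔ ℓ′)
    Conclusion = ∃ λ x → ∃ λ c → Derived c × (ε < c) × (ShapeA x c ⊎ ShapeB x c ⊎ ShapeC x c)

    shapeAB : ∀ {x c} third →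
              SetEq3 x₁ x₂ x₃ x (x ∙ c) (third x) ⊎ SetEq3 x₁ x₂ x₃ (x ⁻¹) (x ⁻¹ ∙ c) (third (x ⁻¹)) →
              SameSubset ⟨ S ⟩ ⟨ Pair c x ⟩ → TypeIV c x → ¬ (c ≈ ε) → ShapeAB x c third
    shapeAB {x} {c} _ shape generated (rel , comm) c≉ε =
      shape , rel , comm , (c , x , generated , rel , comm) ,
      (c , x , generated , rel , commutator≈ε (sym comm) , c≉ε)

    shapeC : ∀ {x c} b → SetEq3 x₁ x₂ x₃ x (x ∙ c) (x ∙ sq c) → (c ^ x ≈ sq c) ⊎ (sq c ^ x ≈ c) →
               SameSubset ⟨ S ⟩ ⟨ Pair c b ⟩ → c ^ b ≈ sq c → ¬ (c ≈ ε) → ShapeC x c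
    shapeC {c = c} b shape rel generated c^b≈c² c≉ε =
      shape , rel , (c , b , generated , c^b≈c²) , (c , b , generated , c^b≈c² , c≉ε)

  module Cases (x₁ x₂ x₃ : Carrier) (x₁<x₂ : x₁ < x₂) (x₁x₂≉x₂x₁ : ¬ (x₁ ∙ x₂ ≈ x₂ ∙ x₁)) where
    open Shapes x₁ x₂ x₃
    open import Relation.Binary.Reasoning.Setoid setoid

    c : Carrier
    c = x₁ ⁻¹ ∙ x₂

    x₂≈x₁c : x₂ ≈ x₁ ∙ c
    x₂≈x₁c = sym (\\-leftDividesˡ x₁ x₂)

    ε<c : ε < c
    ε<c = <-respˡ-≈ (inverseˡ x₁) (∙-monoʳ-< (x₁ ⁻¹) x₁<x₂)

    c≉ε : ¬ (c ≈ ε)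
    c≉ε c≈ε = <⇒≉ ε<c (sym c≈ε)

    x₁≈x₁⁻¹⁻¹ : x₁ ≈ x₁ ⁻¹ ⁻¹
    x₁≈x₁⁻¹⁻¹ = sym (⁻¹-involutive x₁)

    setEq-with-x₁ : ∀ {z} → x₃ ≈ z → SetEq3 x₁ x₂ x₃ x₁ (x₁ ∙ c) z
    setEq-with-x₁ = SetEq3-of-≈ refl x₂≈x₁c

    setEq-with-x₁⁻¹⁻¹ : ∀ {z} → x₃ ≈ z → SetEq3 x₁ x₂ x₃ (x₁ ⁻¹ ⁻¹) (x₁ ⁻¹ ⁻¹ ∙ c) z
    setEq-with-x₁⁻¹⁻¹ = SetEq3-of-≈ x₁≈x₁⁻¹⁻¹ (trans x₂≈x₁c (∙-congʳ x₁≈x₁⁻¹⁻¹))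

    c∈ : ∀ {x} → ⟨ Pair c x ⟩ c
    c∈ = gen (inj₁ refl)

    x∈ : ∀ {x} → ⟨ Pair c x ⟩ x
    x∈ = gen (inj₂ refl)

    generated : ∀ {x w} → ⟨ Pair c x ⟩ x₁ → ⟨ S ⟩ x → x₃ ≈ x₁ ∙ w → ⟨ Pair c x ⟩ w →
                SameSubset ⟨ S ⟩ ⟨ Pair c x ⟩
    generated {x} x₁∈ x∈S x₃≈ w∈ = ⟨⟩-same S⊆ generators⊆
      where
        S⊆ : ∀ {g} → S g → ⟨ Pair c x ⟩ g
        S⊆ (inj₁ g≈x₁)        = resp (sym g≈x₁) x₁∈
        S⊆ (inj₂ (inj₁ g≈x₂)) = resp (sym (trans g≈x₂ x₂≈x₁c)) (mul x₁∈ c∈)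
        S⊆ (inj₂ (inj₂ g≈x₃)) = resp (sym (trans g≈x₃ x₃≈)) (mul x₁∈ w∈)
        generators⊆ : ∀ {g} → Pair c x g → ⟨ S ⟩ g
        generators⊆ (inj₁ g≈c) = resp (sym g≈c) (mul (inv (gen (inj₁ refl))) (gen (inj₂ (inj₁ refl))))
        generators⊆ (inj₂ g≈x) = resp (sym g≈x) x∈S

    generated-by-x₁ : ∀ {w} → x₃ ≈ x₁ ∙ w → ⟨ Pair c x₁ ⟩ w → SameSubset ⟨ S ⟩ ⟨ Pair c x₁ ⟩
    generated-by-x₁ = generated x∈ (gen (inj₁ refl))

    generated-by-x₁⁻¹ : ∀ {w} → x₃ ≈ x₁ ∙ w → ⟨ Pair c (x₁ ⁻¹) ⟩ w → SameSubset ⟨ S ⟩ ⟨ Pair c (x₁ ⁻¹) ⟩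
    generated-by-x₁⁻¹ = generated (resp (⁻¹-involutive x₁) (inv x∈)) (inv (gen (inj₁ refl)))

    -- Case AᵢBⱼ: x₁x₃ is the i-th of x₂x₁, x₂x₂, x₃x₂ and x₃x₁ is the j-th of x₁x₂, x₂x₂, x₂x₃.
    x₃-of-A1 : x₁ ∙ x₃ ≈ x₂ ∙ x₁ → x₃ ≈ x₁ ∙ c ^ x₁
    x₃-of-A1 h = ∙-cancelˡ x₁ x₃ (x₁ ∙ c ^ x₁) (begin
      x₁ ∙ x₃              ≈⟨ h ⟩
      x₂ ∙ x₁              ≈⟨ ∙-congʳ x₂≈x₁c ⟩
      x₁ ∙ c ∙ x₁          ≈⟨ assoc x₁ c x₁ ⟩
      x₁ ∙ (c ∙ x₁)        ≈⟨ ∙-congˡ (∙-^ c x₁) ⟨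
      x₁ ∙ (x₁ ∙ c ^ x₁)   ∎)

    x₃-of-A2 : x₁ ∙ x₃ ≈ x₂ ∙ x₂ → x₃ ≈ x₁ ∙ (c ^ x₁ ∙ c)
    x₃-of-A2 h = ∙-cancelˡ x₁ x₃ (x₁ ∙ (c ^ x₁ ∙ c)) (begin
      x₁ ∙ x₃                    ≈⟨ h ⟩
      x₂ ∙ x₂                    ≈⟨ ∙-cong x₂≈x₁c x₂≈x₁c ⟩
      x₁ ∙ c ∙ (x₁ ∙ c)          ≈⟨ assoc x₁ c (x₁ ∙ c) ⟩
      x₁ ∙ (c ∙ (x₁ ∙ c))        ≈⟨ ∙-congˡ (assoc c x₁ c) ⟨
      x₁ ∙ (c ∙ x₁ ∙ c)          ≈⟨ ∙-congˡ (∙-congʳ (∙-^ c x₁)) ⟨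
      x₁ ∙ (x₁ ∙ c ^ x₁ ∙ c)     ≈⟨ ∙-congˡ (assoc x₁ (c ^ x₁) c) ⟩
      x₁ ∙ (x₁ ∙ (c ^ x₁ ∙ c))   ∎)

    x₃-of-B1 : x₃ ∙ x₁ ≈ x₁ ∙ x₂ → x₃ ≈ x₁ ∙ c ^ (x₁ ⁻¹)
    x₃-of-B1 h = ∙-cancelʳ x₁ x₃ (x₁ ∙ c ^ (x₁ ⁻¹)) (begin
      x₃ ∙ x₁                  ≈⟨ h ⟩
      x₁ ∙ x₂                  ≈⟨ ∙-congˡ x₂≈x₁c ⟩
      x₁ ∙ (x₁ ∙ c)            ≈⟨ ∙-congˡ (^⁻¹-∙ c x₁) ⟨
      x₁ ∙ (c ^ (x₁ ⁻¹) ∙ x₁)  ≈⟨ assoc x₁ (c ^ (x₁ ⁻¹)) x₁ ⟨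
      x₁ ∙ c ^ (x₁ ⁻¹) ∙ x₁    ∎)

    x₃-of-B2 : x₃ ∙ x₁ ≈ x₂ ∙ x₂ → x₃ ≈ x₁ ∙ (c ∙ c ^ (x₁ ⁻¹))
    x₃-of-B2 h = ∙-cancelʳ x₁ x₃ (x₁ ∙ (c ∙ c ^ (x₁ ⁻¹))) (begin
      x₃ ∙ x₁                          ≈⟨ h ⟩
      x₂ ∙ x₂                          ≈⟨ ∙-cong x₂≈x₁c x₂≈x₁c ⟩
      x₁ ∙ c ∙ (x₁ ∙ c)                ≈⟨ ∙-congˡ (^⁻¹-∙ c x₁) ⟨
      x₁ ∙ c ∙ (c ^ (x₁ ⁻¹) ∙ x₁)      ≈⟨ assoc (x₁ ∙ c) (c ^ (x₁ ⁻¹)) x₁ ⟨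
      x₁ ∙ c ∙ c ^ (x₁ ⁻¹) ∙ x₁        ≈⟨ ∙-congʳ (assoc x₁ c (c ^ (x₁ ⁻¹))) ⟩
      x₁ ∙ (c ∙ c ^ (x₁ ⁻¹)) ∙ x₁      ∎)

    case-A1B2 : x₁ ∙ x₃ ≈ x₂ ∙ x₁ → x₃ ∙ x₁ ≈ x₂ ∙ x₂ → Conclusion
    case-A1B2 hA hB = x₁ , c , derived-of-typeIV iv , ε<c ,
      inj₁ (shapeAB (λ y → y ∙ c ^ x₁) (inj₁ (setEq-with-x₁ x₃≈)) (generated-by-x₁ x₃≈ (^-closed c∈ x∈)) iv c≉ε)
      where
        x₃≈ : x₃ ≈ x₁ ∙ c ^ x₁
        x₃≈ = x₃-of-A1 hA
        c^x₁≈ : c ^ x₁ ≈ c ∙ c ^ (x₁ ⁻¹)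
        c^x₁≈ = ∙-cancelˡ x₁ _ _ (trans (sym x₃≈) (x₃-of-B2 hB))
        iv : TypeIV c x₁
        iv = typeIV-of-^sq≈^∙ c x₁ (begin
          c ^ sq x₁                     ≈⟨ ^-^ c x₁ x₁ ⟨
          (c ^ x₁) ^ x₁                 ≈⟨ ^-congˡ x₁ c^x₁≈ ⟩
          (c ∙ c ^ (x₁ ⁻¹)) ^ x₁        ≈⟨ ^-distrib-∙ c (c ^ (x₁ ⁻¹)) x₁ ⟩
          c ^ x₁ ∙ (c ^ (x₁ ⁻¹)) ^ x₁   ≈⟨ ∙-congˡ (^⁻¹-^ c x₁) ⟩
          c ^ x₁ ∙ c                    ∎)

    case-A2B1 : x₁ ∙ x₃ ≈ x₂ ∙ x₂ → x₃ ∙ x₁ ≈ x₁ ∙ x₂ → Conclusion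
    case-A2B1 hA hB = x₁ ⁻¹ , c , derived-of-typeIV iv , ε<c ,
      inj₁ (shapeAB (λ y → y ∙ c ^ (x₁ ⁻¹)) (inj₂ (setEq-with-x₁⁻¹⁻¹ (trans x₃≈ (∙-congʳ x₁≈x₁⁻¹⁻¹))))
                      (generated-by-x₁⁻¹ x₃≈ (^-closed c∈ x∈)) iv c≉ε)
      where
        x₃≈ : x₃ ≈ x₁ ∙ c ^ (x₁ ⁻¹)
        x₃≈ = x₃-of-B1 hB
        c^x₁c≈ : c ^ x₁ ∙ c ≈ c ^ (x₁ ⁻¹)
        c^x₁c≈ = ∙-cancelˡ x₁ _ _ (trans (sym (x₃-of-A2 hA)) x₃≈)
        iv : TypeIV c (x₁ ⁻¹)
        iv = typeIV-of-^sq≈∙^ c (x₁ ⁻¹) (begin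
          c ^ sq (x₁ ⁻¹)                     ≈⟨ ^-^ c (x₁ ⁻¹) (x₁ ⁻¹) ⟨
          (c ^ (x₁ ⁻¹)) ^ (x₁ ⁻¹)            ≈⟨ ^-congˡ (x₁ ⁻¹) c^x₁c≈ ⟨
          (c ^ x₁ ∙ c) ^ (x₁ ⁻¹)             ≈⟨ ^-distrib-∙ (c ^ x₁) c (x₁ ⁻¹) ⟩
          (c ^ x₁) ^ (x₁ ⁻¹) ∙ c ^ (x₁ ⁻¹)   ≈⟨ ∙-congʳ (^-^⁻¹ c x₁) ⟩
          c ∙ c ^ (x₁ ⁻¹)                    ∎)

    case-A2B3 : x₁ ∙ x₃ ≈ x₂ ∙ x₂ → x₃ ∙ x₁ ≈ x₂ ∙ x₃ → Conclusion
    case-A2B3 hA hB = x₁ , c , derived-of-typeIV iv , ε<c ,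
      inj₂ (inj₁ (shapeAB (λ y → y ∙ c ∙ c ^ x₁) (inj₁ (setEq-with-x₁ x₃≈′)) (generated-by-x₁ x₃≈ (mul (^-closed c∈ x∈) c∈)) iv c≉ε))
      where
        v q : Carrier
        v = c ^ x₁
        q = v ∙ c
        x₃≈ : x₃ ≈ x₁ ∙ q
        x₃≈ = x₃-of-A2 hA
        x₁x₁q^x₁≈ : x₁ ∙ (x₁ ∙ q ^ x₁) ≈ x₁ ∙ (x₁ ∙ (v ∙ q))
        x₁x₁q^x₁≈ = begin
          x₁ ∙ (x₁ ∙ q ^ x₁)     ≈⟨ ∙-congˡ (∙-^ q x₁) ⟩
          x₁ ∙ (q ∙ x₁)          ≈⟨ assoc x₁ q x₁ ⟨
          x₁ ∙ q ∙ x₁            ≈⟨ ∙-congʳ x₃≈ ⟨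
          x₃ ∙ x₁                ≈⟨ hB ⟩
          x₂ ∙ x₃                ≈⟨ ∙-cong x₂≈x₁c x₃≈ ⟩
          x₁ ∙ c ∙ (x₁ ∙ q)      ≈⟨ assoc x₁ c (x₁ ∙ q) ⟩
          x₁ ∙ (c ∙ (x₁ ∙ q))    ≈⟨ ∙-congˡ (assoc c x₁ q) ⟨
          x₁ ∙ (c ∙ x₁ ∙ q)      ≈⟨ ∙-congˡ (∙-congʳ (∙-^ c x₁)) ⟨
          x₁ ∙ (x₁ ∙ v ∙ q)      ≈⟨ ∙-congˡ (assoc x₁ v q) ⟩
          x₁ ∙ (x₁ ∙ (v ∙ q))    ∎
        iv : TypeIV c x₁
        iv = typeIV-of-^∙-^ c x₁ (∙-cancelˡ x₁ _ _ (∙-cancelˡ x₁ _ _ x₁x₁q^x₁≈))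
        x₃≈′ : x₃ ≈ x₁ ∙ c ∙ c ^ x₁
        x₃≈′ = trans x₃≈ (trans (∙-congˡ (sym (proj₂ iv))) (sym (assoc x₁ c v)))

    case-A3B2 : x₁ ∙ x₃ ≈ x₃ ∙ x₂ → x₃ ∙ x₁ ≈ x₂ ∙ x₂ → Conclusion
    case-A3B2 hA hB = x₁ ⁻¹ , c , derived-of-typeIV iv , ε<c ,
      inj₂ (inj₁ (shapeAB (λ y → y ∙ c ∙ c ^ (x₁ ⁻¹)) (inj₂ (setEq-with-x₁⁻¹⁻¹ x₃≈′)) (generated-by-x₁⁻¹ x₃≈ (mul c∈ (^-closed c∈ x∈))) iv c≉ε))
      where
        v p : Carrier
        v = c ^ (x₁ ⁻¹)
        p = c ∙ v
        x₃≈ : x₃ ≈ x₁ ∙ p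
        x₃≈ = x₃-of-B2 hB
        x₁p^x₁⁻¹x₁≈ : x₁ ∙ (p ^ (x₁ ⁻¹) ∙ x₁) ≈ x₁ ∙ (p ∙ v ∙ x₁)
        x₁p^x₁⁻¹x₁≈ = begin
          x₁ ∙ (p ^ (x₁ ⁻¹) ∙ x₁)   ≈⟨ ∙-congˡ (^⁻¹-∙ p x₁) ⟩
          x₁ ∙ (x₁ ∙ p)             ≈⟨ ∙-congˡ x₃≈ ⟨
          x₁ ∙ x₃                   ≈⟨ hA ⟩
          x₃ ∙ x₂                   ≈⟨ ∙-cong x₃≈ x₂≈x₁c ⟩
          x₁ ∙ p ∙ (x₁ ∙ c)         ≈⟨ ∙-congˡ (^⁻¹-∙ c x₁) ⟨
          x₁ ∙ p ∙ (v ∙ x₁)         ≈⟨ assoc x₁ p (v ∙ x₁) ⟩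
          x₁ ∙ (p ∙ (v ∙ x₁))       ≈⟨ ∙-congˡ (assoc p v x₁) ⟨
          x₁ ∙ (p ∙ v ∙ x₁)         ∎
        iv : TypeIV c (x₁ ⁻¹)
        iv = typeIV-of-∙^-^ c (x₁ ⁻¹) (∙-cancelʳ x₁ _ _ (∙-cancelˡ x₁ _ _ x₁p^x₁⁻¹x₁≈))
        x₃≈′ : x₃ ≈ x₁ ⁻¹ ⁻¹ ∙ c ∙ c ^ (x₁ ⁻¹)
        x₃≈′ = trans x₃≈ (trans (sym (assoc x₁ c v)) (∙-congʳ (∙-congʳ x₁≈x₁⁻¹⁻¹)))

    case-A1B3 : x₁ ∙ x₃ ≈ x₂ ∙ x₁ → x₃ ∙ x₁ ≈ x₂ ∙ x₃ → Conclusion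
    case-A1B3 hA hB = x₁ , c , derived-of-^≈sq c^x₁≈c² , ε<c ,
      inj₂ (inj₂ (shapeC x₁ (setEq-with-x₁ (trans x₃≈ (∙-congˡ c^x₁≈c²))) (inj₁ c^x₁≈c²)
                          (generated-by-x₁ x₃≈ (^-closed c∈ x∈)) c^x₁≈c² c≉ε))
      where
        x₃≈ : x₃ ≈ x₁ ∙ c ^ x₁
        x₃≈ = x₃-of-A1 hA
        x₁c^x₁x₁≈ : x₁ ∙ (c ^ x₁ ∙ x₁) ≈ x₁ ∙ (sq c ∙ x₁)
        x₁c^x₁x₁≈ = begin
          x₁ ∙ (c ^ x₁ ∙ x₁)     ≈⟨ assoc x₁ (c ^ x₁) x₁ ⟨
          x₁ ∙ c ^ x₁ ∙ x₁       ≈⟨ ∙-congʳ x₃≈ ⟨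
          x₃ ∙ x₁                ≈⟨ hB ⟩
          x₂ ∙ x₃                ≈⟨ ∙-cong x₂≈x₁c x₃≈ ⟩
          x₁ ∙ c ∙ (x₁ ∙ c ^ x₁) ≈⟨ ∙-congˡ (∙-^ c x₁) ⟩
          x₁ ∙ c ∙ (c ∙ x₁)      ≈⟨ assoc x₁ c (c ∙ x₁) ⟩
          x₁ ∙ (c ∙ (c ∙ x₁))    ≈⟨ ∙-congˡ (assoc c c x₁) ⟨
          x₁ ∙ (sq c ∙ x₁)       ∎
        c^x₁≈c² : c ^ x₁ ≈ sq c
        c^x₁≈c² = ∙-cancelʳ x₁ _ _ (∙-cancelˡ x₁ _ _ x₁c^x₁x₁≈)

    case-A3B1 : x₁ ∙ x₃ ≈ x₃ ∙ x₂ → x₃ ∙ x₁ ≈ x₁ ∙ x₂ → Conclusion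
    case-A3B1 hA hB = x₁ , c , derived-of-^≈sq c^x₁⁻¹≈c² , ε<c ,
      inj₂ (inj₂ (shapeC (x₁ ⁻¹) (setEq-with-x₁ (trans x₃≈ (∙-congˡ c^x₁⁻¹≈c²))) (inj₂ c²^x₁≈c)
                          (generated-by-x₁⁻¹ x₃≈ (^-closed c∈ x∈)) c^x₁⁻¹≈c² c≉ε))
      where
        x₃≈ : x₃ ≈ x₁ ∙ c ^ (x₁ ⁻¹)
        x₃≈ = x₃-of-B1 hB
        x₁x₁c^x₁⁻¹≈ : x₁ ∙ (x₁ ∙ c ^ (x₁ ⁻¹)) ≈ x₁ ∙ (x₁ ∙ sq c)
        x₁x₁c^x₁⁻¹≈ = begin
          x₁ ∙ (x₁ ∙ c ^ (x₁ ⁻¹))         ≈⟨ ∙-congˡ x₃≈ ⟨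
          x₁ ∙ x₃                         ≈⟨ hA ⟩
          x₃ ∙ x₂                         ≈⟨ ∙-cong x₃≈ x₂≈x₁c ⟩
          x₁ ∙ c ^ (x₁ ⁻¹) ∙ (x₁ ∙ c)     ≈⟨ assoc x₁ (c ^ (x₁ ⁻¹)) (x₁ ∙ c) ⟩
          x₁ ∙ (c ^ (x₁ ⁻¹) ∙ (x₁ ∙ c))   ≈⟨ ∙-congˡ (assoc (c ^ (x₁ ⁻¹)) x₁ c) ⟨
          x₁ ∙ (c ^ (x₁ ⁻¹) ∙ x₁ ∙ c)     ≈⟨ ∙-congˡ (∙-congʳ (^⁻¹-∙ c x₁)) ⟩
          x₁ ∙ (x₁ ∙ c ∙ c)               ≈⟨ ∙-congˡ (assoc x₁ c c) ⟩
          x₁ ∙ (x₁ ∙ sq c)                ∎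
        c^x₁⁻¹≈c² : c ^ (x₁ ⁻¹) ≈ sq c
        c^x₁⁻¹≈c² = ∙-cancelˡ x₁ _ _ (∙-cancelˡ x₁ _ _ x₁x₁c^x₁⁻¹≈)
        c²^x₁≈c : sq c ^ x₁ ≈ c
        c²^x₁≈c = trans (^-congˡ x₁ (sym c^x₁⁻¹≈c²)) (^⁻¹-^ c x₁)

    impossible-A1B1 : x₁ ∙ x₃ ≈ x₂ ∙ x₁ → x₃ ∙ x₁ ≈ x₁ ∙ x₂ → ⊥
    impossible-A1B1 hA hB = x₁x₂≉x₂x₁ (sym (commute-of-commute-sq (begin
      x₂ ∙ sq x₁        ≈⟨ assoc x₂ x₁ x₁ ⟨
      x₂ ∙ x₁ ∙ x₁      ≈⟨ ∙-congʳ hA ⟨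
      x₁ ∙ x₃ ∙ x₁      ≈⟨ assoc x₁ x₃ x₁ ⟩
      x₁ ∙ (x₃ ∙ x₁)    ≈⟨ ∙-congˡ hB ⟩
      x₁ ∙ (x₁ ∙ x₂)    ≈⟨ assoc x₁ x₁ x₂ ⟨
      sq x₁ ∙ x₂        ∎)))

    impossible-A2B2 : x₁ ∙ x₃ ≈ x₂ ∙ x₂ → x₃ ∙ x₁ ≈ x₂ ∙ x₂ → ⊥
    impossible-A2B2 hA hB = x₁x₂≉x₂x₁ (commute-of-commute-sq (begin
      x₁ ∙ sq x₂        ≈⟨ ∙-congˡ hB ⟨
      x₁ ∙ (x₃ ∙ x₁)    ≈⟨ assoc x₁ x₃ x₁ ⟨
      x₁ ∙ x₃ ∙ x₁      ≈⟨ ∙-congʳ hA ⟩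
      sq x₂ ∙ x₁        ∎))

    impossible-A3B3 : x₁ ∙ x₃ ≈ x₃ ∙ x₂ → x₃ ∙ x₁ ≈ x₂ ∙ x₃ → ⊥
    impossible-A3B3 hA hB = <⇒≉ x₁<x₂ (∙-cancelˡ x₃ x₁ x₂ (trans (sym x₁x₃≈x₃x₁) hA))
      where
        x₁x₃≈x₃x₁ : x₁ ∙ x₃ ≈ x₃ ∙ x₁
        x₁x₃≈x₃x₁ = commute-of-commute-sq (begin
          x₁ ∙ sq x₃        ≈⟨ assoc x₁ x₃ x₃ ⟨
          x₁ ∙ x₃ ∙ x₃      ≈⟨ ∙-congʳ hA ⟩
          x₃ ∙ x₂ ∙ x₃      ≈⟨ assoc x₃ x₂ x₃ ⟩
          x₃ ∙ (x₂ ∙ x₃)    ≈⟨ ∙-congˡ hB ⟨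
          x₃ ∙ (x₃ ∙ x₁)    ≈⟨ assoc x₃ x₃ x₁ ⟨
          sq x₃ ∙ x₁        ∎)

    conclusion-of-cases : (x₁ ∙ x₃ ≈ x₂ ∙ x₁) ⊎ (x₁ ∙ x₃ ≈ x₂ ∙ x₂) ⊎ (x₁ ∙ x₃ ≈ x₃ ∙ x₂) →
                          (x₃ ∙ x₁ ≈ x₁ ∙ x₂) ⊎ (x₃ ∙ x₁ ≈ x₂ ∙ x₂) ⊎ (x₃ ∙ x₁ ≈ x₂ ∙ x₃) → Conclusion
    conclusion-of-cases (inj₁ hA)        (inj₁ hB)        = ⊥-elim (impossible-A1B1 hA hB)
    conclusion-of-cases (inj₁ hA)        (inj₂ (inj₁ hB)) = case-A1B2 hA hB
    conclusion-of-cases (inj₁ hA)        (inj₂ (inj₂ hB)) = case-A1B3 hA hB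
    conclusion-of-cases (inj₂ (inj₁ hA)) (inj₁ hB)        = case-A2B1 hA hB
    conclusion-of-cases (inj₂ (inj₁ hA)) (inj₂ (inj₁ hB)) = ⊥-elim (impossible-A2B2 hA hB)
    conclusion-of-cases (inj₂ (inj₁ hA)) (inj₂ (inj₂ hB)) = case-A2B3 hA hB
    conclusion-of-cases (inj₂ (inj₂ hA)) (inj₁ hB)        = case-A3B1 hA hB
    conclusion-of-cases (inj₂ (inj₂ hA)) (inj₂ (inj₁ hB)) = case-A3B2 hA hB
    conclusion-of-cases (inj₂ (inj₂ hA)) (inj₂ (inj₂ hB)) = ⊥-elim (impossible-A3B3 hA hB)

proposition5p2 : {c ℓ ℓ′ : Level} (G : Group c ℓ) (_≤_ : Rel (Group.Carrier G) ℓ′) →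
  IsOrderedGroup G _≤_ →
  let open Group G
      open GroupNotions G
      _<_ = Strict G _≤_
  in (x₁ x₂ x₃ : Carrier) → x₁ < x₂ → x₂ < x₃ →
     ¬ (x₁ ∙ x₂ ≈ x₂ ∙ x₁) → ¬ (x₂ ∙ x₃ ≈ x₃ ∙ x₂) →
     HasCard (prods3 x₁ x₂ x₃) 7 →
     let S = Three x₁ x₂ x₃ in
     ∃ λ x → ∃ λ c → Derived c × (ε < c) ×
       ( ( ( SetEq3 x₁ x₂ x₃ x (x ∙ c) (x ∙ (c ^ x))
             ⊎ SetEq3 x₁ x₂ x₃ (x ⁻¹) (x ⁻¹ ∙ c) (x ⁻¹ ∙ (c ^ x)) )
           × (c ^ sq x ≈ c ∙ (c ^ x)) × (c ∙ (c ^ x) ≈ (c ^ x) ∙ c)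
           × (∃ λ a → ∃ λ b → SameSubset ⟨ S ⟩ ⟨ Pair a b ⟩
                × (a ^ sq b ≈ a ∙ (a ^ b)) × (a ∙ (a ^ b) ≈ (a ^ b) ∙ a))
           × YoungIV ⟨ S ⟩ )
       ⊎ ( ( SetEq3 x₁ x₂ x₃ x (x ∙ c) (x ∙ c ∙ (c ^ x))
             ⊎ SetEq3 x₁ x₂ x₃ (x ⁻¹) (x ⁻¹ ∙ c) (x ⁻¹ ∙ c ∙ (c ^ x)) )
           × (c ^ sq x ≈ c ∙ (c ^ x)) × (c ∙ (c ^ x) ≈ (c ^ x) ∙ c)
           × (∃ λ a → ∃ λ b → SameSubset ⟨ S ⟩ ⟨ Pair a b ⟩
                × (a ^ sq b ≈ a ∙ (a ^ b)) × (a ∙ (a ^ b) ≈ (a ^ b) ∙ a))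
           × YoungIV ⟨ S ⟩ )
       ⊎ ( SetEq3 x₁ x₂ x₃ x (x ∙ c) (x ∙ sq c)
           × ((c ^ x ≈ sq c) ⊎ (sq c ^ x ≈ c))
           × (∃ λ a → ∃ λ b → SameSubset ⟨ S ⟩ ⟨ Pair a b ⟩ × (a ^ b ≈ sq a))
           × YoungIII ⟨ S ⟩ ) )
proposition5p2 G _≤_ isOrderedGroup x₁ x₂ x₃ x₁<x₂ x₂<x₃ x₁x₂≉x₂x₁ x₂x₃≉x₃x₂ card =
  conclusion-of-cases (x₁x₃-cases card) (x₃x₁-cases card)
  where
    open Classification G _≤_ isOrderedGroup
    open Products x₁ x₂ x₃ x₁<x₂ x₂<x₃ x₁x₂≉x₂x₁ x₂x₃≉x₃x₂
    open Cases x₁ x₂ x₃ x₁<x₂ x₁x₂≉x₂x₁
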